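{- Let $G$ be a diameter-2-critical graph, and for each critical pair $\{x,y\}$ let a shortest $(x,y)$-path $P_{xy}$ be fixed as described in the context. Then every triangle $T$ of $G$ has at least 2 feet, and every foot $v$ of $T$ is adjacent to exactly one vertex of $T$.
   Context: All graphs are finite and simple; $d_G(x,y)$ is the shortest-path distance. $G$ is diameter-2-critical if its diameter is 2 and for every edge $e$, $G-e$ has diameter greater than 2. An unordered vertex pair $\{x,y\}$ and an edge $e$ are associated if $d_G(x,y)\le 2$ but $d_{G-e}(x,y)>2$; a pair $\{x,y\}$ is critical if some edge is associated with it. For each critical pair $\{x,y\}$ one shortest $(x,y)$-path $P_{xy}$ is arbitrarily selected (its critical path). For an edge $e$, $\mathcal{P}(e)$ is the set of critical paths $P_{xy}$ such that $\{x,y\}$ is associated with $e$. For a triangle $T$ (three pairwise adjacent vertices), a vertex $v\notin T$ is a foot of $T$ if there are $x,y\in T$ such that the path $vxy$ belongs to $\mathcal{P}(xy)$. -}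

module Defs where

open import Data.Nat using (ℕ; _≤_)
open import Data.Fin using (Fin)
open import Data.Bool using (Bool; true; false; T)
open import Data.List using (List; []; _∷_; length; reverse)
open import Data.List.Relation.Unary.Unique.Propositional using (Unique)
open import Data.Product using (_×_; ∃; ∃-syntax; Σ)
open import Data.Sum using (_⊎_)
open import Relation.Binary.PropositionalEquality using (_≡_; _≢_)
open import Relation.Nullary using (¬_)

record Graph : Set where
  field
    n     : ℕ
    adj   : Fin n → Fin n → Bool
    sym   : ∀ x y → adj x y ≡ adj y x
    irrefl : ∀ x → adj x x ≡ false

module _ (G : Graph) where
  open Graph G

  V : Set
  V = Fin n

  Adj : V → V → Set
  Adj x y = T (adj x y)

  -- Adjacency in G - e, where e = {u,v} is an edge of G.
  AdjMinus : V → V → V → V → Set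
  AdjMinus u v x y = Adj x y × ¬ ((x ≡ u × y ≡ v) ⊎ (x ≡ v × y ≡ u))

  Dist≤2 : (V → V → Set) → V → V → Set
  Dist≤2 R x y = x ≡ y ⊎ R x y ⊎ (∃[ z ] (R x z × R z y))

  Diameter2 : Set
  Diameter2 = (∀ x y → Dist≤2 Adj x y) × (∃[ x ] ∃[ y ] (x ≢ y × ¬ Adj x y))

  Diameter2Critical : Set
  Diameter2Critical =
    Diameter2 × (∀ u v → Adj u v → ∃[ x ] ∃[ y ] (¬ Dist≤2 (AdjMinus u v) x y))

  Associated : V → V → V → V → Set
  Associated x y u v = Adj u v × Dist≤2 Adj x y × ¬ Dist≤2 (AdjMinus u v) x y

  CriticalPair : V → V → Set
  CriticalPair x y = ∃[ u ] ∃[ v ] Associated x y u v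

  data Walk : V → V → List V → Set where
    here : ∀ {x} → Walk x x (x ∷ [])
    step : ∀ {x z y ps} → Adj x z → Walk z y ps → Walk x (y) (x ∷ ps)

  IsPath : V → V → List V → Set
  IsPath x y ps = Walk x y ps × Unique ps

  ShortestPath : V → V → List V → Set
  ShortestPath x y ps = IsPath x y ps × (∀ qs → Walk x y qs → length ps ≤ length qs)

  -- An arbitrary choice of one shortest path P_{xy} for each critical
  -- (unordered) pair {x,y}: P x y is the path read from x to y, and
  -- P y x is the same path read in the other direction.
  record CriticalPaths : Set where
    field
      P        : V → V → List V
      shortest : ∀ x y → CriticalPair x y → ShortestPath x y (P x y)
      unordered : ∀ x y → CriticalPair x y → P y x ≡ reverse (P x y)

  module _ (CP : CriticalPaths) where
    open CriticalPaths CP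

    InPE : V → V → V → V → Set
    InPE x y u v = CriticalPair x y × Associated x y u v

    Triangle : V → V → V → Set
    Triangle a b c = Adj a b × Adj b c × Adj a c

    InT : V → V → V → V → Set
    InT a b c x = x ≡ a ⊎ x ≡ b ⊎ x ≡ c

    Foot : V → V → V → V → Set
    Foot a b c v =
      ¬ InT a b c v ×
      ∃[ x ] ∃[ y ] (InT a b c x × InT a b c y ×
                     InPE v y x y × P v y ≡ v ∷ x ∷ y ∷ [])

    countAdj : V → V → V → V → ℕ
    countAdj a b c v = b2n (adj v a) Data.Nat.+ b2n (adj v b) Data.Nat.+ b2n (adj v c)
      where
      b2n : Bool → ℕ
      b2n true = 1
      b2n false = 0

-- A pair {f,q} that is associated with an edge pq through the path f p q
-- ("f hangs from p towards q") is rigid: f is nonadjacent to q, and p is the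
-- only neighbour of f among q and the neighbours of q. For a triangle T every
-- vertex of T is q or a neighbour of q, so such an f lies outside T and sees
-- exactly one vertex of T; and a foot of T is precisely a vertex hanging from
-- one edge of T. Conversely, criticality applied to an edge uv of T yields a
-- pair whose every short route uses uv; as the third vertex of T gives a
-- detour between u and v, that pair must hang from u or v. Doing this for two
-- suitably chosen edges of T gives feet attached at different vertices of T,
-- hence two distinct feet.
module Submission where

open import Defs
open import Data.Bool using (true; false; T)
open import Data.Bool.Properties using (T-≡)
open import Data.Empty using (⊥-elim)
open import Data.Fin using (_≟_)
open import Data.List using ([]; _∷_; length)
open import Data.Nat using (_≤_; s≤s)
open import Data.Product using (_×_; ∃-syntax; _,_; proj₁; proj₂)
open import Data.Sum using (_⊎_; inj₁; inj₂)
open import Function using (Equivalence)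
open import Relation.Binary.PropositionalEquality
  using (_≡_; _≢_; refl; sym; subst; ≢-sym)
open import Relation.Nullary using (¬_; yes; no)
open import Relation.Nullary.Decidable using (_×-dec_; _⊎-dec_)

¬T⇒≡false : ∀ {b} → ¬ T b → b ≡ false
¬T⇒≡false {false} _ = refl
¬T⇒≡false {true}  h = ⊥-elim (h _)

module _ {G : Graph} where

  private variable
    f p q s t u v w x y z : V G

  Adj-sym : Adj G x y → Adj G y x
  Adj-sym {x} {y} = subst T (Graph.sym G x y)

  Adj⇒≢ : Adj G x y → x ≢ y
  Adj⇒≢ {x} h refl = subst T (Graph.irrefl G x) h

  Dist≤2-map : {R S : V G → V G → Set} → (∀ {s t} → R s t → S s t) →
               Dist≤2 G R x y → Dist≤2 G S x y
  Dist≤2-map g (inj₁ x≡y)                 = inj₁ x≡y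
  Dist≤2-map g (inj₂ (inj₁ r))            = inj₂ (inj₁ (g r))
  Dist≤2-map g (inj₂ (inj₂ (z , r , r′))) = inj₂ (inj₂ (z , g r , g r′))

  Dist≤2-sym : {R : V G → V G → Set} → (∀ {s t} → R s t → R t s) →
               Dist≤2 G R x y → Dist≤2 G R y x
  Dist≤2-sym g (inj₁ x≡y)                 = inj₁ (sym x≡y)
  Dist≤2-sym g (inj₂ (inj₁ r))            = inj₂ (inj₁ (g r))
  Dist≤2-sym g (inj₂ (inj₂ (z , r , r′))) = inj₂ (inj₂ (z , g r′ , g r))

  AdjMinus-sym : AdjMinus G u v s t → AdjMinus G u v t s
  AdjMinus-sym (st , ¬uv) = Adj-sym st , λ
    { (inj₁ (t≡u , s≡v)) → ¬uv (inj₂ (s≡v , t≡u))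
    ; (inj₂ (t≡v , s≡u)) → ¬uv (inj₁ (s≡u , t≡v)) }

  AdjMinus-swap : AdjMinus G u v s t → AdjMinus G v u s t
  AdjMinus-swap (st , ¬uv) = st , λ
    { (inj₁ e) → ¬uv (inj₂ e)
    ; (inj₂ e) → ¬uv (inj₁ e) }

  AdjMinus-left : Adj G s t → s ≢ u → s ≢ v → AdjMinus G u v s t
  AdjMinus-left st s≢u s≢v = st , λ
    { (inj₁ (s≡u , _)) → s≢u s≡u
    ; (inj₂ (s≡v , _)) → s≢v s≡v }

  AdjMinus-right : Adj G s t → t ≢ u → t ≢ v → AdjMinus G u v s t
  AdjMinus-right st t≢u t≢v = AdjMinus-sym (AdjMinus-left (Adj-sym st) t≢u t≢v)

  AdjMinus-or-removed : Adj G s t →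
    AdjMinus G u v s t ⊎ ((s ≡ u × t ≡ v) ⊎ (s ≡ v × t ≡ u))
  AdjMinus-or-removed {s} {t} {u} {v} st
    with (s ≟ u ×-dec t ≟ v) ⊎-dec (s ≟ v ×-dec t ≟ u)
  ... | yes removed = inj₂ removed
  ... | no  kept    = inj₁ (st , kept)

  detour : Adj G w u → Adj G w v → Dist≤2 G (AdjMinus G u v) u v
  detour wu wv = inj₂ (inj₂ (_ ,
    AdjMinus-right (Adj-sym wu) (Adj⇒≢ wu) (Adj⇒≢ wv) ,
    AdjMinus-left wv (Adj⇒≢ wu) (Adj⇒≢ wv)))

  Far : V G → V G → V G → V G → Set
  Far u v x y = ¬ Dist≤2 G (AdjMinus G u v) x y

  Far-sym : Far u v x y → Far u v y x
  Far-sym far d = far (Dist≤2-sym AdjMinus-sym d)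

  Far-swap : Far u v x y → Far v u x y
  Far-swap far d = far (Dist≤2-map AdjMinus-swap d)

  Hangs : V G → V G → V G → Set
  Hangs f p q = Adj G f p × Far p q f q

  module _ (hangs : Hangs f p q) where

    hangs-≢ : f ≢ q
    hangs-≢ f≡q = proj₂ hangs (inj₁ f≡q)

    hangs-¬Adj : ¬ Adj G f q
    hangs-¬Adj fq = proj₂ hangs (inj₂ (inj₁
      (AdjMinus-left fq (Adj⇒≢ (proj₁ hangs)) hangs-≢)))

    hangs-unique-neighbour : Adj G p q → Adj G f t → t ≡ q ⊎ Adj G t q → t ≡ p
    hangs-unique-neighbour pq ft (inj₁ refl) = ⊥-elim (hangs-¬Adj ft)
    hangs-unique-neighbour {t} pq ft (inj₂ tq) with t ≟ p
    ... | yes t≡p = t≡p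
    ... | no  t≢p = ⊥-elim (proj₂ hangs (inj₂ (inj₂ (t ,
            AdjMinus-left ft (Adj⇒≢ (proj₁ hangs)) hangs-≢ ,
            AdjMinus-left tq t≢p (Adj⇒≢ tq)))))

  unique-short-walk : x ≢ y → ¬ Adj G x y →
    (∀ z → Adj G x z → Adj G z y → z ≡ w) →
    ∀ {ps} → Walk G x y ps → length ps ≤ 3 → ps ≡ x ∷ w ∷ y ∷ []
  unique-short-walk x≢y _ _ here _ = ⊥-elim (x≢y refl)
  unique-short-walk _ ¬xy _ (step xy here) _ = ⊥-elim (¬xy xy)
  unique-short-walk _ _ only (step {z = z} xz (step zy here)) _
    with only z xz zy
  ... | refl = refl
  unique-short-walk _ _ _ (step _ (step _ (step _ here))) (s≤s (s≤s (s≤s ())))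
  unique-short-walk _ _ _ (step _ (step _ (step _ (step _ _)))) (s≤s (s≤s (s≤s ())))

  Walk-head : ∀ {ps} → Walk G x y (x ∷ z ∷ ps) → Adj G x z
  Walk-head (step xz here)       = xz
  Walk-head (step xz (step _ _)) = xz

  far⇒hangs : (∀ x y → Dist≤2 G (Adj G) x y) → Adj G w u → Adj G w v →
    Far u v x y → ∃[ f ] (Hangs f u v ⊎ Hangs f v u)
  far⇒hangs {_} {u} {v} {x} {y} diam wu wv far with diam x y
  ... | inj₁ x≡y = ⊥-elim (far (inj₁ x≡y))
  ... | inj₂ (inj₁ xy) with AdjMinus-or-removed {u = u} {v = v} xy
  ...   | inj₁ kept                   = ⊥-elim (far (inj₂ (inj₁ kept)))
  ...   | inj₂ (inj₁ (refl , refl)) = ⊥-elim (far (detour wu wv))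
  ...   | inj₂ (inj₂ (refl , refl)) =
            ⊥-elim (far (Dist≤2-sym AdjMinus-sym (detour wu wv)))
  far⇒hangs {_} {u} {v} {x} {y} diam wu wv far
      | inj₂ (inj₂ (z , xz , zy))
      with AdjMinus-or-removed {u = u} {v = v} xz
         | AdjMinus-or-removed {u = u} {v = v} zy
  ... | inj₂ (inj₁ (refl , refl)) | _ = y , inj₂ (Adj-sym zy , Far-swap (Far-sym far))
  ... | inj₂ (inj₂ (refl , refl)) | _ = y , inj₁ (Adj-sym zy , Far-sym far)
  ... | inj₁ _ | inj₂ (inj₁ (refl , refl)) = x , inj₁ (xz , far)
  ... | inj₁ _ | inj₂ (inj₂ (refl , refl)) = x , inj₂ (xz , Far-swap far)
  ... | inj₁ xz′ | inj₁ zy′ = ⊥-elim (far (inj₂ (inj₂ (z , xz′ , zy′))))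

  module _ (CP : CriticalPaths G) where
    open CriticalPaths CP

    hangs⇒critical-path : Adj G p q → (hangs : Hangs f p q) →
      InPE G CP f q p q × P f q ≡ f ∷ p ∷ q ∷ []
    hangs⇒critical-path {p} {q} {f} pq hangs@(fp , far) = (crit , assoc) ,
      unique-short-walk (hangs-≢ hangs) (hangs-¬Adj hangs)
        (λ z fz zq → hangs-unique-neighbour hangs pq fz (inj₂ zq))
        (proj₁ (proj₁ shortestP)) (proj₂ shortestP _ (step fp (step pq here)))
      where
      assoc : Associated G f q p q
      assoc = pq , inj₂ (inj₂ (p , fp , pq)) , far
      crit : CriticalPair G f q
      crit = p , q , assoc
      shortestP : ShortestPath G f q (P f q)
      shortestP = shortest f q crit

    module _ {a b c : V G} (tri : Triangle G CP a b c) where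

      private
        InTri : V G → Set
        InTri = InT G CP a b c

        ab : Adj G a b
        ab = proj₁ tri
        bc : Adj G b c
        bc = proj₁ (proj₂ tri)
        ac : Adj G a c
        ac = proj₂ (proj₂ tri)

        a∈T : InTri a
        a∈T = inj₁ refl
        b∈T : InTri b
        b∈T = inj₂ (inj₁ refl)
        c∈T : InTri c
        c∈T = inj₂ (inj₂ refl)

      triangle-clique : InTri s → InTri t → s ≡ t ⊎ Adj G s t
      triangle-clique (inj₁ refl)        (inj₁ refl)        = inj₁ refl
      triangle-clique (inj₁ refl)        (inj₂ (inj₁ refl)) = inj₂ ab
      triangle-clique (inj₁ refl)        (inj₂ (inj₂ refl)) = inj₂ ac
      triangle-clique (inj₂ (inj₁ refl)) (inj₁ refl)        = inj₂ (Adj-sym ab)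
      triangle-clique (inj₂ (inj₁ refl)) (inj₂ (inj₁ refl)) = inj₁ refl
      triangle-clique (inj₂ (inj₁ refl)) (inj₂ (inj₂ refl)) = inj₂ bc
      triangle-clique (inj₂ (inj₂ refl)) (inj₁ refl)        = inj₂ (Adj-sym ac)
      triangle-clique (inj₂ (inj₂ refl)) (inj₂ (inj₁ refl)) = inj₂ (Adj-sym bc)
      triangle-clique (inj₂ (inj₂ refl)) (inj₂ (inj₂ refl)) = inj₁ refl

      AttachedAt : V G → V G → Set
      AttachedAt f p = Adj G f p × (∀ t → InTri t → Adj G f t → t ≡ p)

      hangs⇒attached : InTri q → Adj G p q → Hangs f p q → AttachedAt f p
      hangs⇒attached q∈T pq hangs = proj₁ hangs , λ t t∈T ft →
        hangs-unique-neighbour hangs pq ft (triangle-clique t∈T q∈T)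

      hangs⇒foot : InTri p → InTri q → Adj G p q → Hangs f p q → Foot G CP a b c f
      hangs⇒foot {p} {q} {f} p∈T q∈T pq hangs =
        f∉T , p , q , p∈T , q∈T , hangs⇒critical-path pq hangs
        where
        f∉T : ¬ InTri f
        f∉T f∈T with triangle-clique f∈T q∈T
        ... | inj₁ f≡q = hangs-≢ hangs f≡q
        ... | inj₂ fq  = hangs-¬Adj hangs fq

      foot⇒hangs : Foot G CP a b c f →
        ∃[ p ] ∃[ q ] (InTri p × InTri q × Adj G p q × Hangs f p q)
      foot⇒hangs {f} (_ , p , q , p∈T , q∈T , (crit , pq , _ , far) , Pfq≡fpq) =
        p , q , p∈T , q∈T , pq ,
        Walk-head (subst (Walk G f q) Pfq≡fpq (proj₁ (proj₁ (shortest f q crit)))) ,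
        far

      attached-adj : AttachedAt f p → Graph.adj G f p ≡ true
      attached-adj (fp , _) = Equivalence.to T-≡ fp

      attached-¬adj : AttachedAt f p → InTri t → t ≢ p → Graph.adj G f t ≡ false
      attached-¬adj (_ , only) t∈T t≢p = ¬T⇒≡false (λ ft → t≢p (only _ t∈T ft))

      countAdj-attached : InTri p → AttachedAt f p → countAdj G CP a b c f ≡ 1
      countAdj-attached (inj₁ refl) att
        rewrite attached-adj att
              | attached-¬adj att b∈T (≢-sym (Adj⇒≢ ab))
              | attached-¬adj att c∈T (≢-sym (Adj⇒≢ ac)) = refl
      countAdj-attached (inj₂ (inj₁ refl)) att
        rewrite attached-adj att
              | attached-¬adj att a∈T (Adj⇒≢ ab)
              | attached-¬adj att c∈T (≢-sym (Adj⇒≢ bc)) = refl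
      countAdj-attached (inj₂ (inj₂ refl)) att
        rewrite attached-adj att
              | attached-¬adj att a∈T (Adj⇒≢ ac)
              | attached-¬adj att b∈T (Adj⇒≢ bc) = refl

      foot⇒countAdj≡1 : Foot G CP a b c f → countAdj G CP a b c f ≡ 1
      foot⇒countAdj≡1 foot with foot⇒hangs foot
      ... | p , q , p∈T , q∈T , pq , hangs =
            countAdj-attached p∈T (hangs⇒attached q∈T pq hangs)

      AttachedFoot : V G → V G → Set
      AttachedFoot f p = Foot G CP a b c f × AttachedAt f p

      distinct-feet : InTri p → p ≢ t → AttachedFoot f p → AttachedFoot s t →
        ∃[ v ] ∃[ w ] (v ≢ w × Foot G CP a b c v × Foot G CP a b c w)
      distinct-feet p∈T p≢t (foot , fp , _) (foot′ , _ , only) =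
        _ , _ , (λ { refl → p≢t (only _ p∈T fp) }) , foot , foot′

      edge-foot : Diameter2Critical G → InTri u → InTri v → Adj G u v →
        Adj G w u → Adj G w v →
        ∃[ f ] (AttachedFoot f u ⊎ AttachedFoot f v)
      edge-foot {u} {v} crit u∈T v∈T uv wu wv
        with proj₂ crit u v uv
      ... | _ , _ , far with far⇒hangs (proj₁ (proj₁ crit)) wu wv far
      ...   | f , inj₁ hangs = f , inj₁
              (hangs⇒foot u∈T v∈T uv hangs , hangs⇒attached v∈T uv hangs)
      ...   | f , inj₂ hangs = f , inj₂
              (hangs⇒foot v∈T u∈T (Adj-sym uv) hangs ,
               hangs⇒attached u∈T (Adj-sym uv) hangs)

      two-feet : Diameter2Critical G →
        ∃[ v ] ∃[ w ] (v ≢ w × Foot G CP a b c v × Foot G CP a b c w)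
      two-feet crit
        with edge-foot crit a∈T b∈T ab (Adj-sym ac) (Adj-sym bc)
           | edge-foot crit b∈T c∈T bc ab ac
           | edge-foot crit a∈T c∈T ac (Adj-sym ab) bc
      ... | _ , inj₁ fa | _ , inj₁ gb | _ = distinct-feet a∈T (Adj⇒≢ ab) fa gb
      ... | _ , inj₁ fa | _ , inj₂ gc | _ = distinct-feet a∈T (Adj⇒≢ ac) fa gc
      ... | _ , inj₂ fb | _ | _ , inj₁ ga = distinct-feet b∈T (≢-sym (Adj⇒≢ ab)) fb ga
      ... | _ , inj₂ fb | _ | _ , inj₂ gc = distinct-feet b∈T (Adj⇒≢ bc) fb gc

lemma4p2 : (G : Graph) → Diameter2Critical G → (CP : CriticalPaths G) →
    ∀ a b c → Triangle G CP a b c →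
    (∃[ v ] ∃[ w ] (v ≢ w × Foot G CP a b c v × Foot G CP a b c w)) ×
    (∀ v → Foot G CP a b c v → countAdj G CP a b c v ≡ 1)
lemma4p2 G crit CP a b c tri =
  two-feet CP tri crit , λ v → foot⇒countAdj≡1 CP tri {f = v}
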